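{- Let $\alpha, r$ be positive integers and let $F$ be a graph with $|V(F)|-1 \leq \alpha$. Let $\mathcal H$ be an $r$-uniform, $r$-partite hypergraph and let $\mathcal A\subseteq\mathcal H$ be an $\alpha$-core of $\mathcal H$. If the 2-shadow $\partial_2\mathcal A$ contains a copy of $F$, then $\mathcal A$ (and therefore $\mathcal H$) contains an induced Berge $F$.
   Context: An $r$-uniform hypergraph is a family of $r$-element subsets (edges) of a finite vertex set; it is $r$-partite if its vertex set is partitioned into $r$ parts with every edge meeting each part in exactly one vertex. For a set $S$ of vertices, $\deg_{\mathcal A}(S)$ is the number of edges of $\mathcal A$ containing $S$. An $\alpha$-core of $\mathcal H$ is any subfamily $\mathcal A\subseteq\mathcal H$ such that for every $(r-1)$-element vertex set $S$, either $\deg_{\mathcal A}(S)=0$ or $\deg_{\mathcal A}(S)\ge\alpha$. The 2-shadow $\partial_2\mathcal A$ is the graph whose edges are the pairs of vertices contained in some edge of $\mathcal A$. For a graph $F$ with vertex set $\{v_1,\dots,v_p\}$ and edge set $\{e_1,\dots,e_q\}$, a hypergraph contains an induced Berge $F$ if there exist distinct vertices $W=\{w_1,\dots,w_p\}$ and distinct edges $f_1,\dots,f_q$ of it such that whenever $e_i=v_\alpha v_\beta$ we have $f_i\cap W=\{w_\alpha,w_\beta\}$. -}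

module Defs where

open import Data.Nat using (ℕ; _≤_; _∸_; _<_)
open import Data.Fin using (Fin)
open import Data.Fin.Subset using (Subset; _∈_; _⊆_; ∣_∣)
open import Data.Fin.Subset.Properties using (_⊆?_)
open import Data.List using (List; length; filter)
open import Data.List.Membership.Propositional renaming (_∈_ to _∈ₗ_)
open import Data.List.Relation.Unary.All using (All)
open import Data.List.Relation.Unary.Unique.Propositional using (Unique)
open import Data.Product using (Σ; ∃; _×_; proj₁; proj₂)
open import Data.Sum using (_⊎_)
open import Relation.Binary.PropositionalEquality using (_≡_; _≢_)
open import Relation.Nullary using (¬_)
open import Function.Definitions using (Injective)
open import Function.Bundles using (_⇔_)

Family : ℕ → Set
Family n = List (Subset n)

IsFamily : ∀ {n} → Family n → Set
IsFamily H = Unique H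

Uniform : ∀ {n} → ℕ → Family n → Set
Uniform r H = All (λ e → ∣ e ∣ ≡ r) H

MeetsOnce : ∀ {n r} → (Fin n → Fin r) → Subset n → Fin r → Set
MeetsOnce {n} part e i =
  Σ (Fin n) λ v → (v ∈ e × part v ≡ i) × (∀ w → w ∈ e → part w ≡ i → w ≡ v)

Partite : ∀ {n} → ℕ → Family n → Set
Partite {n} r H =
  Σ (Fin n → Fin r) λ part → All (λ e → ∀ i → MeetsOnce part e i) H

_⊆F_ : ∀ {n} → Family n → Family n → Set
A ⊆F H = All (_∈ₗ H) A

deg : ∀ {n} → Family n → Subset n → ℕ
deg A S = length (filter (λ e → S ⊆? e) A)

-- alpha-core condition (A ⊆ H is required separately)
IsCore : ∀ {n} → ℕ → ℕ → Family n → Set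
IsCore {n} r α A =
  ∀ (S : Subset n) → ∣ S ∣ ≡ r ∸ 1 → deg A S ≡ 0 ⊎ α ≤ deg A S

-- a finite simple graph with vertices Fin p and edges e_0,...,e_{q-1};
-- edge j has endpoints ends j (ordered only for presentation)
record Graph : Set where
  field
    p : ℕ
    q : ℕ
    ends : Fin q → Fin p × Fin p
    loopless : ∀ j → proj₁ (ends j) ≢ proj₂ (ends j)
    simple : ∀ j k → j ≢ k →
      ¬ ((proj₁ (ends j) ≡ proj₁ (ends k) × proj₂ (ends j) ≡ proj₂ (ends k))
         ⊎ (proj₁ (ends j) ≡ proj₂ (ends k) × proj₂ (ends j) ≡ proj₁ (ends k)))
open Graph public

InShadow₂ : ∀ {n} → Family n → Fin n → Fin n → Set
InShadow₂ A x y = x ≢ y × ∃ λ e → e ∈ₗ A × x ∈ e × y ∈ e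

ContainsCopy : ∀ {n} → Family n → Graph → Set
ContainsCopy {n} A F =
  Σ (Fin (p F) → Fin n) λ φ → Injective _≡_ _≡_ φ ×
    (∀ j → InShadow₂ A (φ (proj₁ (ends F j))) (φ (proj₂ (ends F j))))

InducedBerge : ∀ {n} → Family n → Graph → Set
InducedBerge {n} A F =
  Σ (Fin (p F) → Fin n) λ w → Injective _≡_ _≡_ w ×
  Σ (Fin (q F) → Subset n) λ f → Injective _≡_ _≡_ f ×
    (∀ j → f j ∈ₗ A) ×
    (∀ j → ∀ v →
      (v ∈ f j × ∃ (λ k → w k ≡ v))
        ⇔ (v ≡ w (proj₁ (ends F j)) ⊎ v ≡ w (proj₂ (ends F j))))

-- Let w embed F into the 2-shadow of A and let ab be an edge of F, so some edge e of A
-- contains w a and w b. If e also contains w k for a third vertex k, then S = e - w k has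
-- r - 1 vertices and hence lies in at least α ≥ |V(F)| - 1 edges of A. Edges through S
-- differ only in their vertex outside S, so if each of them contained a vertex of w outside S,
-- these vertices would be |V(F)| - 1 distinct images other than w a and w b: impossible.
-- Some edge through S therefore contains w a and w b and strictly fewer images of w than e,
-- and iterating yields an edge meeting the image of w in exactly {w a, w b}. Distinct edges
-- of F get distinct such hyperedges, because a hyperedge determines its pair.
module Submission where

open import Defs
open import Data.Nat using (ℕ; _≤_; _∸_; _<_)
open import Data.Nat using (suc; z≤n; s≤s; s≤s⁻¹)
import Data.Nat.Properties as ℕ
open import Data.Nat.Induction using (<-wellFounded)
open import Data.Fin as Fin using (Fin; punchOut; _≟_)
open import Data.Fin.Properties using (any?; injective⇒≤; punchOut-injective)
open import Data.Fin.Subset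
  using (Subset; inside; outside; _∈_; _∉_; _⊆_; _⊂_; ∣_∣; _∩_; _-_; ⁅_⁆)
open import Data.Fin.Subset.Properties
  using ( _∈?_; _⊆?_; drop-∷-⊆; ⊆-trans; ⊆-antisym; p⊆q⇒∣p∣≤∣q∣; p⊂q⇒∣p∣<∣q∣
        ; p∩q⊆p; p∩q⊆q; x∈p∩q⁺; p─⊥≡p; p─q⊆p; x∈p∧x≢y⇒x∈p-y )
open import Data.Vec using ([]; _∷_; tabulate; here; there)
import Data.Vec as Vec
open import Data.Vec.Properties using (lookup∘tabulate; []=⇒lookup; lookup⇒[]=)
open import Data.List using (List; _∷_; length; lookup; filter)
open import Data.List.Membership.Propositional using (find; lose) renaming (_∈_ to _∈ₗ_)
open import Data.List.Membership.Propositional.Properties using (∈-filter⁺; ∈-filter⁻; ∈-lookup)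
import Data.List.Relation.Unary.All as All
import Data.List.Relation.Unary.Any as Any
open import Data.List.Relation.Unary.AllPairs using (_∷_)
open import Data.List.Relation.Unary.Unique.Propositional using (Unique)
open import Data.List.Relation.Unary.Unique.Propositional.Properties using (filter⁺)
open import Data.Product using (∃; _×_; _,_; proj₁; proj₂)
open import Data.Sum using (_⊎_; inj₁; inj₂)
open import Function using (_∘_)
open import Function.Bundles using (_⇔_; mk⇔)
open import Function.Definitions using (Injective)
open import Induction.WellFounded using (Acc; acc)
open import Relation.Binary.PropositionalEquality using (_≡_; _≢_; refl; sym; trans; cong; subst)
open import Relation.Nullary using (¬_; yes; no; ¬?; contradiction)
open import Relation.Nullary.Decidable using (_×-dec_; _⊎-dec_; decidable-stable)

x∉p-x : ∀ {n} (p : Subset n) (x : Fin n) → x ∉ p - x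
x∉p-x (inside  ∷ p) Fin.zero    ()
x∉p-x (outside ∷ p) Fin.zero    ()
x∉p-x (_       ∷ p) (Fin.suc x) (there x∈p-x) = x∉p-x p x x∈p-x

x∈p⇒suc∣p-x∣≡∣p∣ : ∀ {n} {p : Subset n} {x} → x ∈ p → suc ∣ p - x ∣ ≡ ∣ p ∣
x∈p⇒suc∣p-x∣≡∣p∣ {p = inside  ∷ p} here        = cong (suc ∘ ∣_∣) (p─⊥≡p p)
x∈p⇒suc∣p-x∣≡∣p∣ {p = inside  ∷ p} (there x∈p) = cong suc (x∈p⇒suc∣p-x∣≡∣p∣ x∈p)
x∈p⇒suc∣p-x∣≡∣p∣ {p = outside ∷ p} (there x∈p) = x∈p⇒suc∣p-x∣≡∣p∣ x∈p

p⊆q∧∣q∣≤∣p∣⇒p≡q : ∀ {n} {p q : Subset n} → p ⊆ q → ∣ q ∣ ≤ ∣ p ∣ → p ≡ q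
p⊆q∧∣q∣≤∣p∣⇒p≡q {p = []}          {[]}          _   _  = refl
p⊆q∧∣q∣≤∣p∣⇒p≡q {p = outside ∷ p} {outside ∷ q} p⊆q le =
  cong (outside ∷_) (p⊆q∧∣q∣≤∣p∣⇒p≡q (drop-∷-⊆ p⊆q) le)
p⊆q∧∣q∣≤∣p∣⇒p≡q {p = outside ∷ p} {inside  ∷ q} p⊆q le =
  contradiction (p⊆q⇒∣p∣≤∣q∣ (drop-∷-⊆ p⊆q)) (ℕ.<⇒≱ le)
p⊆q∧∣q∣≤∣p∣⇒p≡q {p = inside  ∷ p} {outside ∷ q} p⊆q le = contradiction (p⊆q here) λ ()
p⊆q∧∣q∣≤∣p∣⇒p≡q {p = inside  ∷ p} {inside  ∷ q} p⊆q le =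
  cong (inside ∷_) (p⊆q∧∣q∣≤∣p∣⇒p≡q (drop-∷-⊆ p⊆q) (s≤s⁻¹ le))

p⊈q⇒∃∈p∉q : ∀ {n} {p q : Subset n} → ¬ p ⊆ q → ∃ λ x → x ∈ p × x ∉ q
p⊈q⇒∃∈p∉q {p = p} {q} p⊈q =
  decidable-stable (any? λ x → x ∈? p ×-dec ¬? (x ∈? q)) λ none →
    p⊈q λ {x} x∈p → decidable-stable (x ∈? q) λ x∉q → none (x , x∈p , x∉q)

one-point-extension-⊆ : ∀ {n} {S e₁ e₂ : Subset n} {x} → S ⊆ e₁ → S ⊆ e₂ →
  ∣ e₁ ∣ ≡ suc ∣ S ∣ → x ∈ e₁ → x ∈ e₂ → x ∉ S → e₁ ⊆ e₂
one-point-extension-⊆ {S = S} {e₁} {e₂} {x} S⊆e₁ S⊆e₂ ∣e₁∣≡ x∈e₁ x∈e₂ x∉S =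
  subst (_⊆ e₂) e₁∩e₂≡e₁ (p∩q⊆q e₁ e₂)
  where
  S⊂e₁∩e₂ : S ⊂ e₁ ∩ e₂
  S⊂e₁∩e₂ = (λ y∈S → x∈p∩q⁺ (S⊆e₁ y∈S , S⊆e₂ y∈S)) , x , x∈p∩q⁺ (x∈e₁ , x∈e₂) , x∉S

  e₁∩e₂≡e₁ : e₁ ∩ e₂ ≡ e₁
  e₁∩e₂≡e₁ = p⊆q∧∣q∣≤∣p∣⇒p≡q (p∩q⊆p e₁ e₂)
    (subst (_≤ ∣ e₁ ∩ e₂ ∣) (sym ∣e₁∣≡) (p⊂q⇒∣p∣<∣q∣ S⊂e₁∩e₂))

one-point-extensions-≡ : ∀ {n} {S e₁ e₂ : Subset n} {x} → S ⊆ e₁ → S ⊆ e₂ →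
  ∣ e₁ ∣ ≡ suc ∣ S ∣ → ∣ e₂ ∣ ≡ suc ∣ S ∣ → x ∈ e₁ → x ∈ e₂ → x ∉ S → e₁ ≡ e₂
one-point-extensions-≡ S⊆e₁ S⊆e₂ ∣e₁∣≡ ∣e₂∣≡ x∈e₁ x∈e₂ x∉S = ⊆-antisym
  (one-point-extension-⊆ S⊆e₁ S⊆e₂ ∣e₁∣≡ x∈e₁ x∈e₂ x∉S)
  (one-point-extension-⊆ S⊆e₂ S⊆e₁ ∣e₂∣≡ x∈e₂ x∈e₁ x∉S)

Unique⇒lookup-injective : ∀ {a} {A : Set a} {xs : List A} → Unique xs →
  ∀ i j → lookup xs i ≡ lookup xs j → i ≡ j
Unique⇒lookup-injective (_    ∷ _) Fin.zero    Fin.zero    _  = refl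
Unique⇒lookup-injective (x∉xs ∷ _) Fin.zero    (Fin.suc j) eq =
  contradiction eq (All.lookup x∉xs (∈-lookup j))
Unique⇒lookup-injective (x∉xs ∷ _) (Fin.suc i) Fin.zero    eq =
  contradiction (sym eq) (All.lookup x∉xs (∈-lookup i))
Unique⇒lookup-injective (_    ∷ u) (Fin.suc i) (Fin.suc j) eq =
  cong Fin.suc (Unique⇒lookup-injective u i j eq)

∈⇒0<length : ∀ {a} {A : Set a} {x : A} {xs} → x ∈ₗ xs → 0 < length xs
∈⇒0<length {xs = _ ∷ _} _ = s≤s z≤n

injective-avoiding-two⇒< : ∀ {m k} {a b : Fin k} {g : Fin m → Fin k} → a ≢ b →
  Injective _≡_ _≡_ g → (∀ i → g i ≢ a) → (∀ i → g i ≢ b) → m < k ∸ 1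
injective-avoiding-two⇒< {k = 1} {Fin.zero} {Fin.zero} a≢b _ _ _ = contradiction refl a≢b
injective-avoiding-two⇒< {m} {suc (suc k)} {a} {b} {g} a≢b g-injective g≢a g≢b =
  s≤s (injective⇒≤ h-injective)
  where
  a≢g : ∀ i → a ≢ g i
  a≢g i = g≢a i ∘ sym

  b≢g : ∀ i → punchOut a≢b ≢ punchOut (a≢g i)
  b≢g i eq = g≢b i (sym (punchOut-injective a≢b (a≢g i) eq))

  h : Fin m → Fin k
  h i = punchOut (b≢g i)

  h-injective : Injective _≡_ _≡_ h
  h-injective {i} {j} eq = g-injective
    (punchOut-injective (a≢g i) (a≢g j) (punchOut-injective (b≢g i) (b≢g j) eq))

IsCore⇒α≤deg : ∀ {n r α} {A : Family n} {S e} → IsCore r α A → ∣ S ∣ ≡ r ∸ 1 →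
  e ∈ₗ A → S ⊆ e → α ≤ deg A S
IsCore⇒α≤deg {S = S} core ∣S∣≡ e∈A S⊆e with core S ∣S∣≡
... | inj₂ α≤deg = α≤deg
... | inj₁ deg≡0 =
  contradiction (sym deg≡0) (ℕ.<⇒≢ (∈⇒0<length (∈-filter⁺ (S ⊆?_) e∈A S⊆e)))

module Trace {n m} (w : Fin m → Fin n) where

  trace : Subset n → Subset m
  trace e = tabulate (λ k → Vec.lookup e (w k))

  ∈-trace⁺ : ∀ {e k} → w k ∈ e → k ∈ trace e
  ∈-trace⁺ {e} {k} wk∈e =
    lookup⇒[]= k (trace e) (trans (lookup∘tabulate _ k) ([]=⇒lookup wk∈e))

  ∈-trace⁻ : ∀ {e k} → k ∈ trace e → w k ∈ e
  ∈-trace⁻ {e} {k} k∈e =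
    lookup⇒[]= (w k) e (trans (sym (lookup∘tabulate _ k)) ([]=⇒lookup k∈e))

  trace-mono : ∀ {e₁ e₂} → e₁ ⊆ e₂ → trace e₁ ⊆ trace e₂
  trace-mono e₁⊆e₂ = ∈-trace⁺ ∘ e₁⊆e₂ ∘ ∈-trace⁻

  Induces : Fin m → Fin m → Subset n → Set
  Induces a b e = w a ∈ e × w b ∈ e × (∀ k → w k ∈ e → k ≡ a ⊎ k ≡ b)

  Induces⇒⇔ : ∀ {a b e} → Induces a b e →
    ∀ v → (v ∈ e × ∃ (λ k → w k ≡ v)) ⇔ (v ≡ w a ⊎ v ≡ w b)
  Induces⇒⇔ {a} {b} {e} (wa∈e , wb∈e , only-a-b) v = mk⇔ to from
    where
    to : v ∈ e × ∃ (λ k → w k ≡ v) → v ≡ w a ⊎ v ≡ w b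
    to (v∈e , k , refl) with only-a-b k v∈e
    ... | inj₁ refl = inj₁ refl
    ... | inj₂ refl = inj₂ refl

    from : v ≡ w a ⊎ v ≡ w b → v ∈ e × ∃ (λ k → w k ≡ v)
    from (inj₁ refl) = wa∈e , a , refl
    from (inj₂ refl) = wb∈e , b , refl

induced-edges-injective : ∀ {n} (F : Graph) (w : Fin (p F) → Fin n) (f : Fin (q F) → Subset n) →
  (∀ j → Trace.Induces w (proj₁ (ends F j)) (proj₂ (ends F j)) (f j)) → Injective _≡_ _≡_ f
induced-edges-injective F w f induces {j} {j′} fj≡fj′ with j ≟ j′
... | yes j≡j′ = j≡j′
... | no  j≢j′
  with ends-of-j∈fj′ (proj₁ (induces j)) | ends-of-j∈fj′ (proj₁ (proj₂ (induces j)))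
  where
  ends-of-j∈fj′ : ∀ {k} → w k ∈ f j → k ≡ proj₁ (ends F j′) ⊎ k ≡ proj₂ (ends F j′)
  ends-of-j∈fj′ wk∈fj = proj₂ (proj₂ (induces j′)) _ (subst (w _ ∈_) fj≡fj′ wk∈fj)
... | inj₁ a≡a′ | inj₁ b≡a′ = contradiction (trans a≡a′ (sym b≡a′)) (loopless F j)
... | inj₁ a≡a′ | inj₂ b≡b′ = contradiction (inj₁ (a≡a′ , b≡b′)) (simple F j j′ j≢j′)
... | inj₂ a≡b′ | inj₁ b≡a′ = contradiction (inj₂ (a≡b′ , b≡a′)) (simple F j j′ j≢j′)
... | inj₂ a≡b′ | inj₂ b≡b′ = contradiction (trans a≡b′ (sym b≡b′)) (loopless F j)

module Descent {n m r α} {A : Family n} (w : Fin m → Fin n) (w-injective : Injective _≡_ _≡_ w)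
  (A-unique : Unique A) (A-uniform : Uniform r A) (A-core : IsCore r α A) (m∸1≤α : m ∸ 1 ≤ α)
  where

  open Trace w

  extensions : Subset n → Family n
  extensions S = filter (S ⊆?_) A

  extension-free-of-new-images : ∀ {S e a b} → e ∈ₗ A → S ⊆ e → ∣ e ∣ ≡ suc ∣ S ∣ →
    a ≢ b → w a ∈ S → w b ∈ S → ∃ λ e′ → e′ ∈ₗ A × S ⊆ e′ × trace e′ ⊆ trace S
  extension-free-of-new-images {S} {e} {a} {b} e∈A S⊆e ∣e∣≡ a≢b wa∈S wb∈S =
    let (e′ , e′∈L , e′-free) =
          find (decidable-stable (Any.any? (λ e′ → trace e′ ⊆? trace S) L) no-free-impossible)
    in  e′ , proj₁ (extension e′∈L) , proj₂ (extension e′∈L) , e′-free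
    where
    L : Family n
    L = extensions S

    extension : ∀ {e′} → e′ ∈ₗ L → e′ ∈ₗ A × S ⊆ e′
    extension = ∈-filter⁻ (S ⊆?_) {xs = A}

    ∣extension∣≡ : ∀ {e′} → e′ ∈ₗ L → ∣ e′ ∣ ≡ suc ∣ S ∣
    ∣extension∣≡ e′∈L = trans (All.lookup A-uniform (proj₁ (extension e′∈L)))
                              (trans (sym (All.lookup A-uniform e∈A)) ∣e∣≡)

    α≤∣L∣ : α ≤ length L
    α≤∣L∣ = IsCore⇒α≤deg {r = r} A-core
      (cong (_∸ 1) (trans (sym ∣e∣≡) (All.lookup A-uniform e∈A))) e∈A S⊆e

    no-free-impossible : ¬ ¬ Any.Any (λ e′ → trace e′ ⊆ trace S) L
    no-free-impossible none =
      ℕ.<⇒≱ (injective-avoiding-two⇒< a≢b G-injective (G≢ wa∈S) (G≢ wb∈S))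
            (ℕ.≤-trans m∸1≤α α≤∣L∣)
      where
      new : ∀ i → ∃ λ k → k ∈ trace (lookup L i) × k ∉ trace S
      new i = p⊈q⇒∃∈p∉q (none ∘ lose (∈-lookup i))

      G : Fin (length L) → Fin m
      G i = proj₁ (new i)

      G≢ : ∀ {c} → w c ∈ S → ∀ i → G i ≢ c
      G≢ wc∈S i refl = proj₂ (proj₂ (new i)) (∈-trace⁺ wc∈S)

      G-injective : Injective _≡_ _≡_ G
      G-injective {i} {j} Gi≡Gj = Unique⇒lookup-injective (filter⁺ (S ⊆?_) A-unique) i j
        (one-point-extensions-≡ (proj₂ (extension (∈-lookup i))) (proj₂ (extension (∈-lookup j)))
          (∣extension∣≡ (∈-lookup i)) (∣extension∣≡ (∈-lookup j))
          (∈-trace⁻ (proj₁ (proj₂ (new i))))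
          (∈-trace⁻ (subst (_∈ trace (lookup L j)) (sym Gi≡Gj) (proj₁ (proj₂ (new j)))))
          (proj₂ (proj₂ (new i)) ∘ ∈-trace⁺))

  shrink : ∀ {e a b k} → e ∈ₗ A → a ≢ b → w a ∈ e → w b ∈ e → w k ∈ e → ¬ (k ≡ a ⊎ k ≡ b) →
    ∃ λ e′ → e′ ∈ₗ A × w a ∈ e′ × w b ∈ e′ × trace e′ ⊂ trace e
  shrink {e} {a} {b} {k} e∈A a≢b wa∈e wb∈e wk∈e k∉ab =
    let (e′ , e′∈A , S⊆e′ , e′-free) =
          extension-free-of-new-images e∈A (p─q⊆p e ⁅ w k ⁆) (sym (x∈p⇒suc∣p-x∣≡∣p∣ wk∈e)) a≢b
            (stays wa∈e (k∉ab ∘ inj₁)) (stays wb∈e (k∉ab ∘ inj₂))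
    in  e′ , e′∈A , S⊆e′ (stays wa∈e (k∉ab ∘ inj₁)) , S⊆e′ (stays wb∈e (k∉ab ∘ inj₂))
      , ⊆-trans e′-free (trace-mono (p─q⊆p e ⁅ w k ⁆))
      , k , ∈-trace⁺ wk∈e , x∉p-x e (w k) ∘ ∈-trace⁻ ∘ e′-free
    where
    stays : ∀ {c} → w c ∈ e → k ≢ c → w c ∈ e - w k
    stays wc∈e k≢c = x∈p∧x≢y⇒x∈p-y wc∈e (k≢c ∘ sym ∘ w-injective)

  descend : ∀ {a b e} → a ≢ b → Acc _<_ ∣ trace e ∣ → e ∈ₗ A → w a ∈ e → w b ∈ e →
    ∃ λ e′ → e′ ∈ₗ A × Induces a b e′
  descend {a} {b} {e} a≢b (acc smaller) e∈A wa∈e wb∈e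
    with any? (λ k → w k ∈? e ×-dec ¬? (k ≟ a ⊎-dec k ≟ b))
  ... | no no-other = e , e∈A , wa∈e , wb∈e , λ k wk∈e →
    decidable-stable (k ≟ a ⊎-dec k ≟ b) (λ k∉ab → no-other (k , wk∈e , k∉ab))
  ... | yes (k , wk∈e , k∉ab) =
    let (e′ , e′∈A , wa∈e′ , wb∈e′ , e′⊂e) = shrink e∈A a≢b wa∈e wb∈e wk∈e k∉ab
    in  descend a≢b (smaller (p⊂q⇒∣p∣<∣q∣ e′⊂e)) e′∈A wa∈e′ wb∈e′

lemma3p3 : (α r : ℕ) → 0 < α → 0 < r → (F : Graph) → p F ∸ 1 ≤ α →
    (n : ℕ) (H A : Family n) → IsFamily H → Uniform r H → Partite r H →
    IsFamily A → A ⊆F H → IsCore r α A →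
    ContainsCopy A F → InducedBerge A F
lemma3p3 α r _ _ F p∸1≤α n H A _ H-uniform _ A-unique A⊆H A-core (w , w-injective , in-shadow) =
  w , w-injective , f , induced-edges-injective F w f induces , f∈A , λ j → Induces⇒⇔ (induces j)
  where
  open Trace w
  open Descent w w-injective A-unique (All.map (All.lookup H-uniform) A⊆H) A-core p∸1≤α

  induced-edge : ∀ j → ∃ λ e → e ∈ₗ A × Induces (proj₁ (ends F j)) (proj₂ (ends F j)) e
  induced-edge j =
    let (_ , e , e∈A , wa∈e , wb∈e) = in-shadow j
    in  descend (loopless F j) (<-wellFounded _) e∈A wa∈e wb∈e

  f : Fin (q F) → Subset n
  f = proj₁ ∘ induced-edge

  f∈A : ∀ j → f j ∈ₗ A
  f∈A = proj₁ ∘ proj₂ ∘ induced-edge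

  induces : ∀ j → Induces (proj₁ (ends F j)) (proj₂ (ends F j)) (f j)
  induces = proj₂ ∘ proj₂ ∘ induced-edge
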